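{- Let $P=(X,\prec)$ be a finite poset with $n=|X|$ elements, let $x,y\in X$ be distinct, and for integers $j$ let $F(j)$ be the number of linear extensions $L$ of $P$ with $L(y)-L(x)=j$. Suppose $k\in\{2,\dots,n-2\}$ and $F(k)>0$. Suppose there is an element $z\in\{x,y\}$ such that for every linear extension $L$ with $L(y)-L(x)=k$ there are elements $u,v\in X$ with $u\,\|\,z$, $v\,\|\,z$ and $L(u)+1=L(z)=L(v)-1$. Then $F(k)=F(k+1)=F(k-1)$.
   Context: A linear extension of $P$ is a bijection $L:X\to\{1,\dots,n\}$ with $L(u)<L(v)$ whenever $u\prec v$. $u\,\|\,v$ means $u$ and $v$ are incomparable in $P$. -}

module Defs where

open import Data.Nat using (ℕ; zero; suc; _+_; _<_)
open import Data.Fin using (Fin; toℕ)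
open import Data.Fin.Properties using (all?; any?) renaming (_≟_ to _≟ᶠ_)
open import Data.Nat.Properties using () renaming (_≟_ to _≟ℕ_; _<?_ to _<ℕ?_)
open import Data.List using (List; []; _∷_; concatMap; map; length; filter)
open import Data.List.Base using () renaming ([_] to single)
open import Data.Vec.Functional using () renaming (_∷_ to _∷ᶠ_)
open import Data.Product using (Σ; _×_; _,_; ∃)
open import Relation.Binary.PropositionalEquality using (_≡_)
open import Relation.Binary.Core using (Rel)
open import Relation.Binary.Definitions using (Decidable)
open import Relation.Nullary using (¬_; Dec)
open import Relation.Nullary.Decidable using (_×-dec_; _→-dec_; ¬?)
open import Data.List using () renaming (allFin to allFinList)

Incomparable : ∀ {n} (_≺_ : Rel (Fin n) _) → Fin n → Fin n → Set
Incomparable _≺_ u v = ¬ (u ≺ v) × ¬ (v ≺ u)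

-- A linear extension: a bijection L : Fin n → Fin n (positions 0..n-1,
-- i.e. the paper's 1..n shifted by one) with L u < L v whenever u ≺ v.
IsLinearExtension : ∀ {n} (_≺_ : Rel (Fin n) _) → (Fin n → Fin n) → Set
IsLinearExtension {n} _≺_ L =
  (∀ a b → L a ≡ L b → a ≡ b)
  × (∀ p → ∃ λ a → L a ≡ p)
  × (∀ u v → u ≺ v → toℕ (L u) < toℕ (L v))

isLinearExtension? : ∀ {n} (_≺_ : Rel (Fin n) _) → Decidable _≺_ →
                     ∀ L → Dec (IsLinearExtension _≺_ L)
isLinearExtension? _≺_ _≺?_ L =
  all? (λ a → all? (λ b → (L a ≟ᶠ L b) →-dec (a ≟ᶠ b)))
  ×-dec all? (λ p → any? (λ a → L a ≟ᶠ p))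
  ×-dec all? (λ u → all? (λ v → (u ≺? v) →-dec (toℕ (L u) <ℕ? toℕ (L v))))

allFuns : ∀ m n → List (Fin m → Fin n)
allFuns zero n = single (λ ())
allFuns (suc m) n = concatMap (λ f → map (λ a → a ∷ᶠ f) (allFinList n)) (allFuns m n)

-- F(j): number of linear extensions L with L(y) - L(x) = j  (for j ∈ ℕ,
-- which suffices: the theorem only uses j = k-1, k, k+1 ≥ 1).
F : ∀ {n} (_≺_ : Rel (Fin n) _) → Decidable _≺_ → Fin n → Fin n → ℕ → ℕ
F {n} _≺_ _≺?_ x y j =
  length (filter (λ L → isLinearExtension? _≺_ _≺?_ L
                         ×-dec (toℕ (L y) ≟ℕ (toℕ (L x) + j)))
                 (allFuns n n))

-- Assume z = x; the case z = y is the same statement for the dual order, with x and y exchanged.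
-- Swapping x with its incomparable predecessor maps the linear extensions with gap k injectively
-- to those with gap k+1, and swapping x with its successor maps back, provided that in every
-- extension with gap k+1 the successor w of x satisfies x ⊀ w.  If instead x ≺ w, then every c
-- strictly between x and y satisfies x ≺ c ≺ y: otherwise moving the first offending c next to x
-- (or next to y) gives an extension with gap k in which x has a comparable neighbour.  These k
-- elements then lie between x and y in every linear extension, but one with gap k only has room
-- for k-1 of them.  Symmetrically, in every extension with gap k-1 the element x has a predecessor
-- u with u ⊀ x: otherwise everything below x is ≺ x and everything above y is ≻ y, which bounds
-- the gap of every linear extension by k-1.
module Submission where

open import Defs
open import Level using (0ℓ)
open import Data.Empty using (⊥-elim)
import Data.Fin as Fin
open Fin using (Fin; toℕ; fromℕ<; punchIn; punchOut; opposite)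
open import Data.Fin.Properties
  using (_≟_; toℕ-injective; toℕ<n; toℕ-fromℕ<; fromℕ<-injective; injective⇒≤; any?;
         punchIn-injective; punchInᵢ≢i; punchIn-mono-≤; punchOut-cong; punchOut-injective;
         punchOut-mono-≤; punchOut-punchIn; punchIn-punchOut; opposite-prop; opposite-involutive)
  renaming (≤∧≢⇒< to ≤∧≢⇒<ᶠ; <⇒≢ to <⇒≢ᶠ)
open import Data.List using ([]; _∷_; map; concatMap; _++_; length; filter; lookup; cartesianProductWith)
open import Data.List using () renaming (allFin to allFinList)
open import Data.List.Relation.Unary.All using (All; []; _∷_)
import Data.List.Relation.Unary.All as All
open import Data.List.Relation.Unary.All.Properties using (all-filter)
open import Data.List.Relation.Unary.AllPairs using ([]; _∷_)
open import Data.List.Relation.Unary.Any using (here; index)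
open import Data.List.Relation.Unary.Unique.Setoid using (Unique)
open import Data.List.Relation.Unary.Unique.Setoid.Properties using (cartesianProductWith⁺; filter⁺)
open import Data.List.Relation.Unary.Unique.Propositional.Properties using (allFin⁺)
import Data.List.Membership.Setoid as Membership
open import Data.List.Membership.Setoid.Properties
  using (∈-cartesianProductWith⁺; ∈-filter⁺; ∈-resp-≈; index-injective)
open import Data.List.Membership.Propositional.Properties using (∈-allFin; ∈-lookup)
open import Data.Nat using (ℕ; zero; suc; _+_; _∸_; _≤_; _<_; _≤?_; z≤n; s≤s; s≤s⁻¹; z<s; s<s; ≢-nonZero)
open import Data.Nat.Induction using (<-wellFounded)
open import Data.Nat.Properties
  using (≤-refl; ≤-reflexive; ≤-antisym; <-irrefl; <-trans; <⇒≤; <⇒≢; ≤∧≢⇒<; ≤-<-trans; <-≤-trans; ≰⇒>;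
         m≤n⇒m<n∨m≡n; n<1+n; m≤m+n; m<m+n; 1+n≢0; suc-injective; pred[n]≤n; suc-pred;
         +-comm; +-assoc; +-suc; +-identityʳ; +-monoˡ-≤; +-monoʳ-<; +-cancelˡ-≡; +-cancelʳ-≡;
         ∸-monoˡ-<; ∸-monoʳ-<; ∸-cancelʳ-≡; m∸n+n≡m; m+[n∸m]≡n; module ≤-Reasoning)
  renaming (_≟_ to _≟ℕ_)
open import Data.Product using (Σ; ∃; _×_; _,_; proj₁; proj₂)
import Data.Product as Product
open import Data.Sum using (_⊎_; inj₁; inj₂)
import Data.Sum as Sum
open import Data.Vec.Functional using () renaming (_∷_ to _∷ᶠ_)
open import Function using (_∘_; flip)
open import Induction.WellFounded using (Acc; acc)
open import Relation.Binary.Bundles using (Setoid)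
open import Relation.Binary.Core using (Rel)
import Relation.Binary.Construct.Flip.Ord as Flip
open import Relation.Binary.Definitions using (Decidable; Transitive; _Respects_)
open import Relation.Binary.PropositionalEquality
  using (_≡_; _≢_; _≗_; refl; sym; trans; cong; subst; subst₂; setoid; _→-setoid_; module ≡-Reasoning)
open import Relation.Binary.Structures using (IsStrictPartialOrder)
open import Relation.Nullary using (¬_; yes; no; contradiction)
open import Relation.Nullary.Decidable using (_×-dec_)
open import Relation.Unary using (Pred)
import Relation.Unary

-- Moving a position

toℕ-punchIn-< : ∀ {n} (i : Fin (suc n)) (j : Fin n) → toℕ j < toℕ i → toℕ (punchIn i j) ≡ toℕ j
toℕ-punchIn-< (Fin.suc i) Fin.zero    _         = refl
toℕ-punchIn-< (Fin.suc i) (Fin.suc j) (s<s j<i) = cong suc (toℕ-punchIn-< i j j<i)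

toℕ-punchIn-≥ : ∀ {n} (i : Fin (suc n)) (j : Fin n) → toℕ i ≤ toℕ j → toℕ (punchIn i j) ≡ suc (toℕ j)
toℕ-punchIn-≥ Fin.zero    j           _         = refl
toℕ-punchIn-≥ (Fin.suc i) (Fin.suc j) (s≤s i≤j) = cong suc (toℕ-punchIn-≥ i j i≤j)

toℕ-punchOut-< : ∀ {n} {i j : Fin (suc n)} (i≢j : i ≢ j) → toℕ j < toℕ i → toℕ (punchOut i≢j) ≡ toℕ j
toℕ-punchOut-< {suc n} {Fin.suc i} {Fin.zero}  _   _         = refl
toℕ-punchOut-< {suc n} {Fin.suc i} {Fin.suc j} i≢j (s<s j<i) =
  cong suc (toℕ-punchOut-< (i≢j ∘ cong Fin.suc) j<i)

toℕ-punchOut-> : ∀ {n} {i j : Fin (suc n)} (i≢j : i ≢ j) → toℕ i < toℕ j → suc (toℕ (punchOut i≢j)) ≡ toℕ j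
toℕ-punchOut-> {_}     {Fin.zero}  {Fin.suc j} _   _         = refl
toℕ-punchOut-> {suc n} {Fin.suc i} {Fin.suc j} i≢j (s<s i<j) =
  cong suc (toℕ-punchOut-> (i≢j ∘ cong Fin.suc) i<j)

-- move i j takes position i to position j and shifts the positions in between by one towards i.
move : ∀ {n} → Fin n → Fin n → Fin n → Fin n
move {suc _} i j k with k ≟ i
... | yes _   = j
... | no  k≢i = punchIn j (punchOut (k≢i ∘ sym))

move-source : ∀ {n} (i j : Fin n) → move i j i ≡ j
move-source {suc _} i j with i ≟ i
... | yes _   = refl
... | no  i≢i = contradiction refl i≢i

move-other : ∀ {n} {i k : Fin (suc n)} (j : Fin (suc n)) (i≢k : i ≢ k) →
             move i j k ≡ punchIn j (punchOut i≢k)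
move-other {i = i} {k} j i≢k with k ≟ i
... | yes k≡i = contradiction (sym k≡i) i≢k
... | no  _   = cong (punchIn j) (punchOut-cong i refl)

move-inverse : ∀ {n} (i j k : Fin n) → move j i (move i j k) ≡ k
move-inverse {suc _} i j k with i ≟ k
... | yes refl = trans (cong (move j i) (move-source i j)) (move-source j i)
... | no  i≢k  = begin
  move j i (move i j k)                        ≡⟨ cong (move j i) (move-other j i≢k) ⟩
  move j i (punchIn j (punchOut i≢k))          ≡⟨ move-other i (punchInᵢ≢i j _ ∘ sym) ⟩
  punchIn i (punchOut (punchInᵢ≢i j _ ∘ sym))  ≡⟨ cong (punchIn i) (punchOut-punchIn j) ⟩
  punchIn i (punchOut i≢k)                     ≡⟨ punchIn-punchOut i≢k ⟩
  k                                            ∎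
  where open ≡-Reasoning

move-injective : ∀ {n} (i j : Fin n) {k k′} → move i j k ≡ move i j k′ → k ≡ k′
move-injective i j {k} {k′} eq = trans (sym (move-inverse i j k)) (trans (cong (move j i) eq) (move-inverse i j k′))

move∘-injective : ∀ {m n} {L M : Fin m → Fin n} {i i′ j j′ : Fin n} → i ≡ i′ → j ≡ j′ →
                  (move i j ∘ L) ≗ (move i′ j′ ∘ M) → L ≗ M
move∘-injective refl refl eq k = move-injective _ _ (eq k)

module _ {n} (i j : Fin (suc n)) where

  move-mono-< : ∀ {k k′} → i ≢ k → i ≢ k′ → toℕ k < toℕ k′ → toℕ (move i j k) < toℕ (move i j k′)
  move-mono-< {k} {k′} i≢k i≢k′ k<k′ =
    subst₂ (λ a b → toℕ a < toℕ b) (sym (move-other j i≢k)) (sym (move-other j i≢k′)) punchIn<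
    where
    punchOut< : toℕ (punchOut i≢k) < toℕ (punchOut i≢k′)
    punchOut< = ≤∧≢⇒<ᶠ (punchOut-mono-≤ i≢k i≢k′ (<⇒≤ k<k′)) (<⇒≢ᶠ k<k′ ∘ punchOut-injective i≢k i≢k′)
    punchIn< : toℕ (punchIn j (punchOut i≢k)) < toℕ (punchIn j (punchOut i≢k′))
    punchIn< = ≤∧≢⇒<ᶠ (punchIn-mono-≤ j _ _ (<⇒≤ punchOut<)) (<⇒≢ᶠ punchOut< ∘ punchIn-injective j _ _)

  module _ {k : Fin (suc n)} where
    open ≡-Reasoning

    private
      toℕ-≢ : ∀ {a b : Fin (suc n)} → toℕ a ≢ toℕ b → a ≢ b
      toℕ-≢ ne = ne ∘ cong toℕ

    move-below : toℕ k < toℕ i → toℕ k < toℕ j → toℕ (move i j k) ≡ toℕ k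
    move-below k<i k<j = begin
      toℕ (move i j k)                ≡⟨ cong toℕ (move-other j i≢k) ⟩
      toℕ (punchIn j (punchOut i≢k))  ≡⟨ toℕ-punchIn-< j _ (subst (_< toℕ j) (sym out≡) k<j) ⟩
      toℕ (punchOut i≢k)              ≡⟨ out≡ ⟩
      toℕ k                           ∎
      where
      i≢k : i ≢ k
      i≢k = toℕ-≢ (<⇒≢ k<i ∘ sym)
      out≡ : toℕ (punchOut i≢k) ≡ toℕ k
      out≡ = toℕ-punchOut-< i≢k k<i

    move-above : toℕ i < toℕ k → toℕ j < toℕ k → toℕ (move i j k) ≡ toℕ k
    move-above i<k j<k = begin
      toℕ (move i j k)                ≡⟨ cong toℕ (move-other j i≢k) ⟩
      toℕ (punchIn j (punchOut i≢k))  ≡⟨ toℕ-punchIn-≥ j _ (s≤s⁻¹ (subst (toℕ j <_) (sym out≡) j<k)) ⟩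
      suc (toℕ (punchOut i≢k))        ≡⟨ out≡ ⟩
      toℕ k                           ∎
      where
      i≢k : i ≢ k
      i≢k = toℕ-≢ (<⇒≢ i<k)
      out≡ : suc (toℕ (punchOut i≢k)) ≡ toℕ k
      out≡ = toℕ-punchOut-> i≢k i<k

    move-shiftUp : toℕ j ≤ toℕ k → toℕ k < toℕ i → toℕ (move i j k) ≡ suc (toℕ k)
    move-shiftUp j≤k k<i = begin
      toℕ (move i j k)                ≡⟨ cong toℕ (move-other j i≢k) ⟩
      toℕ (punchIn j (punchOut i≢k))  ≡⟨ toℕ-punchIn-≥ j _ (subst (toℕ j ≤_) (sym out≡) j≤k) ⟩
      suc (toℕ (punchOut i≢k))        ≡⟨ cong suc out≡ ⟩
      suc (toℕ k)                     ∎
      where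
      i≢k : i ≢ k
      i≢k = toℕ-≢ (<⇒≢ k<i ∘ sym)
      out≡ : toℕ (punchOut i≢k) ≡ toℕ k
      out≡ = toℕ-punchOut-< i≢k k<i

    move-shiftDown : toℕ i < toℕ k → toℕ k ≤ toℕ j → suc (toℕ (move i j k)) ≡ toℕ k
    move-shiftDown i<k k≤j = begin
      suc (toℕ (move i j k))                ≡⟨ cong (suc ∘ toℕ) (move-other j i≢k) ⟩
      suc (toℕ (punchIn j (punchOut i≢k)))  ≡⟨ cong suc (toℕ-punchIn-< j _ (subst (_≤ toℕ j) (sym out≡) k≤j)) ⟩
      suc (toℕ (punchOut i≢k))              ≡⟨ out≡ ⟩
      toℕ k                                 ∎
      where
      i≢k : i ≢ k
      i≢k = toℕ-≢ (<⇒≢ i<k)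
      out≡ : suc (toℕ (punchOut i≢k)) ≡ toℕ k
      out≡ = toℕ-punchOut-> i≢k i<k

-- Descent along a measure

module _ {a ℓ ℓ′} {A : Set a} {_⊏_ : Rel A ℓ} (⊏-trans : Transitive _⊏_)
         (δ : A → ℕ) {W : Pred A ℓ′} {e : A} where

  descent⇒⊏ : (∀ {c} → W c → ∃ λ d → δ d < δ c × d ⊏ c × (d ≡ e ⊎ W d)) →
              ∀ {c} → W c → e ⊏ c
  descent⇒⊏ step Wc = go Wc (<-wellFounded _)
    where
    go : ∀ {c} → W c → Acc _<_ (δ c) → e ⊏ c
    go Wc (acc rs) with step Wc
    ... | d , _     , d⊏c , inj₁ refl = d⊏c
    ... | d , δd<δc , d⊏c , inj₂ Wd   = ⊏-trans (go Wd (rs δd<δc)) d⊏c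

-- Counting by injections

injective-between⇒≤ : ∀ {m lo hi} (g : Fin m → ℕ) → lo ≤ hi →
                      (∀ i → lo ≤ g i) → (∀ i → g i < hi) →
                      (∀ {i j} → g i ≡ g j → i ≡ j) → m + lo ≤ hi
injective-between⇒≤ {lo = lo} {hi} g lo≤hi lo≤g g<hi g-injective =
  subst (_ + lo ≤_) (m∸n+n≡m lo≤hi) (+-monoˡ-≤ lo (injective⇒≤ h-injective))
  where
  h : Fin _ → Fin (hi ∸ lo)
  h i = fromℕ< (∸-monoˡ-< (g<hi i) (lo≤g i))
  h-injective : ∀ {i j} → h i ≡ h j → i ≡ j
  h-injective {i} {j} eq = g-injective (∸-cancelʳ-≡ (lo≤g i) (lo≤g j) (fromℕ<-injective _ _ _ _ eq))

module _ {a ℓ} (S : Setoid a ℓ) where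
  open Setoid S using (_≈_) renaming (sym to ≈-sym)

  Unique-lookup-injective : ∀ {xs} → Unique S xs → ∀ {i j} → lookup xs i ≈ lookup xs j → i ≡ j
  Unique-lookup-injective (_ ∷ _)      {Fin.zero}  {Fin.zero}  _  = refl
  Unique-lookup-injective (x∉ ∷ _)     {Fin.zero}  {Fin.suc j} eq = contradiction eq (All.lookup x∉ (∈-lookup j))
  Unique-lookup-injective (x∉ ∷ _)     {Fin.suc i} {Fin.zero}  eq = contradiction (≈-sym eq) (All.lookup x∉ (∈-lookup i))
  Unique-lookup-injective (_ ∷ unique) {Fin.suc i} {Fin.suc j} eq = cong Fin.suc (Unique-lookup-injective unique eq)

allFuns-cartesianProduct : ∀ m n →
  allFuns (suc m) n ≡ cartesianProductWith (λ f a → a ∷ᶠ f) (allFuns m n) (allFinList n)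
allFuns-cartesianProduct m n = go (allFuns m n)
  where
  go : ∀ fs → concatMap (λ f → map (_∷ᶠ f) (allFinList n)) fs ≡
              cartesianProductWith (λ f a → a ∷ᶠ f) fs (allFinList n)
  go []       = refl
  go (f ∷ fs) = cong (map (_∷ᶠ f) (allFinList n) ++_) (go fs)

allFuns-unique : ∀ m n → Unique (Fin m →-setoid Fin n) (allFuns m n)
allFuns-unique zero    n = [] ∷ []
allFuns-unique (suc m) n = subst (Unique (Fin (suc m) →-setoid Fin n)) (sym (allFuns-cartesianProduct m n))
  (cartesianProductWith⁺ (Fin m →-setoid Fin n) (setoid (Fin n)) (Fin (suc m) →-setoid Fin n)
    _ (λ eq → (eq ∘ Fin.suc) , eq Fin.zero) (allFuns-unique m n) (allFin⁺ n))

allFuns-complete : ∀ m n (f : Fin m → Fin n) → Membership._∈_ (Fin m →-setoid Fin n) f (allFuns m n)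
allFuns-complete zero    n f = here (λ ())
allFuns-complete (suc m) n f =
  subst (Membership._∈_ (Fin (suc m) →-setoid Fin n) f) (sym (allFuns-cartesianProduct m n))
    (∈-resp-≈ (Fin (suc m) →-setoid Fin n) (λ { Fin.zero → refl ; (Fin.suc i) → refl })
      (∈-cartesianProductWith⁺ (Fin m →-setoid Fin n) (setoid (Fin n)) (Fin (suc m) →-setoid Fin n)
        (λ f≗g a≡b → λ { Fin.zero → a≡b ; (Fin.suc i) → f≗g i })
        (allFuns-complete m n (f ∘ Fin.suc)) (∈-allFin (f Fin.zero))))

module _ {m n} {P Q : Pred (Fin m → Fin n) 0ℓ}
         (P? : Relation.Unary.Decidable P) (Q? : Relation.Unary.Decidable Q) (Q-resp : Q Respects _≗_) where
  private
    S : Setoid 0ℓ 0ℓ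
    S = Fin m →-setoid Fin n
    open Membership S using (_∈_)

  filter-length-≤ : (φ : ∀ {f} → P f → Fin m → Fin n) → (∀ {f} (p : P f) → Q (φ p)) →
                    (∀ {f g} (p : P f) (q : P g) → φ p ≗ φ q → f ≗ g) →
                    length (filter P? (allFuns m n)) ≤ length (filter Q? (allFuns m n))
  filter-length-≤ φ φ-Q φ-injective = injective⇒≤ {f = index ∘ image∈} injective
    where
    P-lookup : ∀ i → P (lookup (filter P? (allFuns m n)) i)
    P-lookup i = All.lookup (all-filter P? (allFuns m n)) (∈-lookup i)
    image∈ : ∀ i → φ (P-lookup i) ∈ filter Q? (allFuns m n)
    image∈ i = ∈-filter⁺ S Q? Q-resp (allFuns-complete m n _) (φ-Q (P-lookup i))
    injective : ∀ {i j} → index (image∈ i) ≡ index (image∈ j) → i ≡ j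
    injective eq = Unique-lookup-injective S (filter⁺ S P? (allFuns-unique m n))
                     (φ-injective _ _ (index-injective S (image∈ _) (image∈ _) eq))

nonempty-filter⇒∃ : ∀ {a p} {A : Set a} {P : Pred A p} (P? : Relation.Unary.Decidable P) xs →
                    0 < length (filter P? xs) → ∃ P
nonempty-filter⇒∃ {P = P} P? xs = go (all-filter P? xs)
  where
  go : ∀ {ys} → All P ys → 0 < length ys → ∃ P
  go (Pa ∷ _) _ = _ , Pa

-- Linear extensions

module _ {n} (_≺_ : Rel (Fin n) 0ℓ) {L : Fin n → Fin n} (le : IsLinearExtension _≺_ L) where

  position-injective : ∀ {a b} → toℕ (L a) ≡ toℕ (L b) → a ≡ b
  position-injective eq = proj₁ le _ _ (toℕ-injective eq)

  ≺⇒position< : ∀ {a b} → a ≺ b → toℕ (L a) < toℕ (L b)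
  ≺⇒position< = proj₂ (proj₂ le) _ _

  ≺-irreflexive : ∀ {a} → ¬ (a ≺ a)
  ≺-irreflexive a≺a = <-irrefl refl (≺⇒position< a≺a)

  position-≤⇒≡⊎< : ∀ {a b} → toℕ (L a) ≤ toℕ (L b) → a ≡ b ⊎ toℕ (L a) < toℕ (L b)
  position-≤⇒≡⊎< a≤b = Sum.swap (Sum.map₂ position-injective (m≤n⇒m<n∨m≡n a≤b))

  elementAt : ∀ {q} → q < n → ∃ λ a → toℕ (L a) ≡ q
  elementAt q<n with proj₁ (proj₂ le) (fromℕ< q<n)
  ... | a , La≡q = a , trans (cong toℕ La≡q) (toℕ-fromℕ< q<n)

  element-before : ∀ {a} → toℕ (L a) ≢ 0 → ∃ λ u → suc (toℕ (L u)) ≡ toℕ (L a)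
  element-before {a} a≢0 with elementAt (≤-<-trans pred[n]≤n (toℕ<n (L a)))
  ... | u , u≡ = u , trans (cong suc u≡) (suc-pred (toℕ (L a)) {{≢-nonZero a≢0}})

  element-after : ∀ {a} → suc (toℕ (L a)) < n → ∃ λ w → suc (toℕ (L a)) ≡ toℕ (L w)
  element-after a+1<n = Product.map₂ sym (elementAt a+1<n)

IsLinearExtension-resp-≗ : ∀ {n} (_≺_ : Rel (Fin n) 0ℓ) {L M} → L ≗ M →
                           IsLinearExtension _≺_ L → IsLinearExtension _≺_ M
IsLinearExtension-resp-≗ _≺_ L≗M (injective , surjective , monotone) =
  (λ a b eq → injective a b (trans (L≗M a) (trans eq (sym (L≗M b)))))
  , (λ p → proj₁ (surjective p) , trans (sym (L≗M _)) (proj₂ (surjective p)))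
  , (λ u v u≺v → subst₂ _<_ (cong toℕ (L≗M u)) (cong toℕ (L≗M v)) (monotone u v u≺v))

window⇒≤ : ∀ {n} (_≺_ : Rel (Fin n) 0ℓ) {L M} → IsLinearExtension _≺_ L → IsLinearExtension _≺_ M →
           ∀ {lo m lo′ hi′} → lo + m ≤ n → lo′ ≤ hi′ →
           (∀ c → lo ≤ toℕ (L c) → toℕ (L c) < lo + m → lo′ ≤ toℕ (M c) × toℕ (M c) < hi′) →
           m + lo′ ≤ hi′
window⇒≤ {n} _≺_ {L} {M} leL leM {lo} {m} {lo′} {hi′} bound lo′≤hi′ window =
  injective-between⇒≤ (toℕ ∘ M ∘ element) lo′≤hi′ (proj₁ ∘ inWindow) (proj₂ ∘ inWindow) injective
  where
  element-exists : (t : Fin m) → ∃ λ c → toℕ (L c) ≡ lo + toℕ t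
  element-exists t = elementAt _≺_ leL (<-≤-trans (+-monoʳ-< lo (toℕ<n t)) bound)
  element : Fin m → Fin n
  element = proj₁ ∘ element-exists
  inWindow : ∀ t → lo′ ≤ toℕ (M (element t)) × toℕ (M (element t)) < hi′
  inWindow t = window (element t) (subst (lo ≤_) (sym (proj₂ (element-exists t))) (m≤m+n lo (toℕ t)))
                 (subst (_< lo + m) (sym (proj₂ (element-exists t))) (+-monoʳ-< lo (toℕ<n t)))
  injective : ∀ {t t′} → toℕ (M (element t)) ≡ toℕ (M (element t′)) → t ≡ t′
  injective {t} {t′} eq = toℕ-injective (+-cancelˡ-≡ lo _ _ (begin
    lo + toℕ t              ≡⟨ proj₂ (element-exists t) ⟨
    toℕ (L (element t))     ≡⟨ cong (toℕ ∘ L) (position-injective _≺_ leM eq) ⟩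
    toℕ (L (element t′))    ≡⟨ proj₂ (element-exists t′) ⟩
    lo + toℕ t′             ∎))
    where open ≡-Reasoning

module _ {n} (_≺_ : Rel (Fin (suc n)) 0ℓ) {L : Fin (suc n) → Fin (suc n)} (le : IsLinearExtension _≺_ L) where

  move-linearExtension : ∀ c a → (∀ e → e ≺ c → toℕ (L e) < toℕ a) → (∀ e → c ≺ e → toℕ a < toℕ (L e)) →
                         IsLinearExtension _≺_ (move (L c) a ∘ L)
  move-linearExtension c a before after = injective , surjective , monotone
    where
    injective : ∀ u v → move (L c) a (L u) ≡ move (L c) a (L v) → u ≡ v
    injective u v eq = proj₁ le u v (move-injective (L c) a eq)

    surjective : ∀ p → ∃ λ e → move (L c) a (L e) ≡ p
    surjective p = Product.map₂ (λ Le≡ → trans (cong (move (L c) a) Le≡) (move-inverse a (L c) p))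
                     (proj₁ (proj₂ le) (move a (L c) p))

    monotone : ∀ u v → u ≺ v → toℕ (move (L c) a (L u)) < toℕ (move (L c) a (L v))
    monotone u v u≺v with c ≟ u | c ≟ v
    ... | yes refl | yes refl = contradiction u≺v (≺-irreflexive _≺_ le)
    ... | yes refl | no _ =
      subst₂ _<_ (sym (cong toℕ (move-source (L c) a))) (sym (move-above (L c) a (≺⇒position< _≺_ le u≺v) (after v u≺v)))
        (after v u≺v)
    ... | no _ | yes refl =
      subst₂ _<_ (sym (move-below (L c) a (≺⇒position< _≺_ le u≺v) (before u u≺v))) (sym (cong toℕ (move-source (L c) a)))
        (before u u≺v)
    ... | no c≢u | no c≢v =
      move-mono-< (L c) a (c≢u ∘ proj₁ le c u) (c≢v ∘ proj₁ le c v) (≺⇒position< _≺_ le u≺v)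

  module _ (_≺?_ : Decidable _≺_) where

    predecessor⊎movable : ∀ c a → toℕ a ≤ toℕ (L c) →
                          (∃ λ d → d ≺ c × toℕ a ≤ toℕ (L d)) ⊎ IsLinearExtension _≺_ (move (L c) a ∘ L)
    predecessor⊎movable c a a≤c with any? (λ d → (d ≺? c) ×-dec (toℕ a ≤? toℕ (L d)))
    ... | yes found = inj₁ found
    ... | no none   = inj₂ (move-linearExtension c a
                             (λ e e≺c → ≰⇒> (λ a≤e → none (e , e≺c , a≤e)))
                             (λ e c≺e → ≤-<-trans a≤c (≺⇒position< _≺_ le c≺e)))

    successor⊎movable : ∀ c a → toℕ (L c) ≤ toℕ a →
                        (∃ λ d → c ≺ d × toℕ (L d) ≤ toℕ a) ⊎ IsLinearExtension _≺_ (move (L c) a ∘ L)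
    successor⊎movable c a c≤a with any? (λ d → (c ≺? d) ×-dec (toℕ (L d) ≤? toℕ a))
    ... | yes found = inj₁ found
    ... | no none   = inj₂ (move-linearExtension c a
                             (λ e e≺c → <-≤-trans (≺⇒position< _≺_ le e≺c) c≤a)
                             (λ e c≺e → ≰⇒> (λ e≤a → none (e , c≺e , e≤a))))

  module _ {a b} (adjacent : suc (toℕ (L a)) ≡ toℕ (L b)) (a⊀b : ¬ (a ≺ b)) where

    moveDown-linearExtension : IsLinearExtension _≺_ (move (L b) (L a) ∘ L)
    moveDown-linearExtension = move-linearExtension b (L a)
      (λ e e≺b → ≤∧≢⇒< (s≤s⁻¹ (subst (toℕ (L e) <_) (sym adjacent) (≺⇒position< _≺_ le e≺b)))
                         (λ e≡a → a⊀b (subst (_≺ b) (position-injective _≺_ le e≡a) e≺b)))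
      (λ e b≺e → <-trans (subst (toℕ (L a) <_) adjacent (n<1+n _)) (≺⇒position< _≺_ le b≺e))

    moveUp-linearExtension : IsLinearExtension _≺_ (move (L a) (L b) ∘ L)
    moveUp-linearExtension = move-linearExtension a (L b)
      (λ e e≺a → <-trans (≺⇒position< _≺_ le e≺a) (subst (toℕ (L a) <_) adjacent (n<1+n _)))
      (λ e a≺e → ≤∧≢⇒< (subst (_≤ toℕ (L e)) adjacent (≺⇒position< _≺_ le a≺e))
                         (λ b≡e → a⊀b (subst (a ≺_) (position-injective _≺_ le (sym b≡e)) a≺e)))

opposite-+ : ∀ {n} (i : Fin n) → toℕ (opposite i) + suc (toℕ i) ≡ n
opposite-+ i = trans (cong (_+ suc (toℕ i)) (opposite-prop i)) (m∸n+n≡m (toℕ<n i))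

opposite-gap : ∀ {n} {a b : Fin n} j → toℕ b ≡ toℕ a + j → toℕ (opposite a) ≡ toℕ (opposite b) + j
opposite-gap {a = a} {b} j b≡a+j = +-cancelʳ-≡ (suc (toℕ a)) _ _ (begin
  toℕ (opposite a) + suc (toℕ a)        ≡⟨ opposite-+ a ⟩
  _                                     ≡⟨ opposite-+ b ⟨
  toℕ (opposite b) + suc (toℕ b)        ≡⟨ cong (λ t → toℕ (opposite b) + suc t) (trans b≡a+j (+-comm (toℕ a) j)) ⟩
  toℕ (opposite b) + suc (j + toℕ a)    ≡⟨ cong (toℕ (opposite b) +_) (+-suc j (toℕ a)) ⟨
  toℕ (opposite b) + (j + suc (toℕ a))  ≡⟨ +-assoc (toℕ (opposite b)) j (suc (toℕ a)) ⟨
  toℕ (opposite b) + j + suc (toℕ a)    ∎)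
  where open ≡-Reasoning

opposite-adjacent : ∀ {n} {a b : Fin n} → suc (toℕ (opposite a)) ≡ toℕ (opposite b) → suc (toℕ b) ≡ toℕ a
opposite-adjacent {a = a} {b} adjacent =
  trans (+-comm 1 (toℕ b)) (sym (subst₂ (λ s t → toℕ s ≡ toℕ t + 1) (opposite-involutive a) (opposite-involutive b)
    (opposite-gap 1 (trans (sym adjacent) (+-comm 1 _)))))

opposite-injective : ∀ {n} {i j : Fin n} → opposite i ≡ opposite j → i ≡ j
opposite-injective {i = i} {j} eq =
  trans (sym (opposite-involutive i)) (trans (cong opposite eq) (opposite-involutive j))

opposite∘-injective : ∀ {m n} {L M : Fin m → Fin n} → (opposite ∘ L) ≗ (opposite ∘ M) → L ≗ M
opposite∘-injective eq = opposite-injective ∘ eq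

opposite-linearExtension : ∀ {n} (_≺_ : Rel (Fin n) 0ℓ) {L} →
                           IsLinearExtension _≺_ L → IsLinearExtension (flip _≺_) (opposite ∘ L)
opposite-linearExtension _≺_ {L} (injective , surjective , monotone) =
  (λ a b → injective a b ∘ opposite-injective)
  , (λ p → Product.map₂ (λ eq → trans (cong opposite eq) (opposite-involutive p)) (surjective (opposite p)))
  , (λ u v v≺u → subst₂ _<_ (sym (opposite-prop (L u))) (sym (opposite-prop (L v)))
                   (∸-monoʳ-< (s≤s (monotone v u v≺u)) (toℕ<n (L u))))

-- Counting linear extensions by the gap L(y) - L(x)

module _ {n} (_≺_ : Rel (Fin n) 0ℓ) (x : Fin n) where

  SwappableDown : Pred (Fin n → Fin n) 0ℓ
  SwappableDown L = ∃ λ u → suc (toℕ (L u)) ≡ toℕ (L x) × ¬ (u ≺ x)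

  SwappableUp : Pred (Fin n → Fin n) 0ℓ
  SwappableUp L = ∃ λ w → suc (toℕ (L x)) ≡ toℕ (L w) × ¬ (x ≺ w)

module _ {n} (_≺_ : Rel (Fin n) 0ℓ) (x y : Fin n) where

  WithGap : ℕ → Pred (Fin n → Fin n) 0ℓ
  WithGap j L = IsLinearExtension _≺_ L × toℕ (L y) ≡ toℕ (L x) + j

  WithGap-resp-≗ : ∀ j → WithGap j Respects _≗_
  WithGap-resp-≗ j L≗M (le , gap) =
    IsLinearExtension-resp-≗ _≺_ L≗M le , subst₂ (λ a b → toℕ a ≡ toℕ b + j) (L≗M y) (L≗M x) gap

module _ {n} (_≺_ : Rel (Fin n) 0ℓ) (_≺?_ : Decidable _≺_) (x y : Fin n) where

  -- The decision procedure of the definition of F, so that F counts the elements of WithGap j.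
  withGap? : ∀ j → Relation.Unary.Decidable (WithGap _≺_ x y j)
  withGap? j L = isLinearExtension? _≺_ _≺?_ L ×-dec (toℕ (L y) ≟ℕ (toℕ (L x) + j))

  F-≤ : ∀ {j j′} (φ : ∀ {L} → WithGap _≺_ x y j L → Fin n → Fin n) →
        (∀ {L} (p : WithGap _≺_ x y j L) → WithGap _≺_ x y j′ (φ p)) →
        (∀ {L M} (p : WithGap _≺_ x y j L) (q : WithGap _≺_ x y j M) → φ p ≗ φ q → L ≗ M) →
        F _≺_ _≺?_ x y j ≤ F _≺_ _≺?_ x y j′
  F-≤ {j} {j′} = filter-length-≤ (withGap? j) (withGap? j′) (WithGap-resp-≗ _≺_ x y j′)

module _ {n} (_≺_ : Rel (Fin n) 0ℓ) (_≺?_ : Decidable _≺_) (x y : Fin n) where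

  F-opposite : ∀ j → F _≺_ _≺?_ x y j ≡ F (flip _≺_) (flip _≺?_) y x j
  F-opposite j = ≤-antisym
    (filter-length-≤ (withGap? _≺_ _≺?_ x y j) (withGap? (flip _≺_) (flip _≺?_) y x j)
       (WithGap-resp-≗ (flip _≺_) y x j) (λ {L} _ → opposite ∘ L)
       (λ (le , gap) → opposite-linearExtension _≺_ le , opposite-gap j gap) (λ _ _ → opposite∘-injective))
    (filter-length-≤ (withGap? (flip _≺_) (flip _≺?_) y x j) (withGap? _≺_ _≺?_ x y j)
       (WithGap-resp-≗ _≺_ x y j) (λ {L} _ → opposite ∘ L)
       (λ (le , gap) → opposite-linearExtension (flip _≺_) le , opposite-gap j gap) (λ _ _ → opposite∘-injective))

  F-opposite-≡ : ∀ {i j} → F (flip _≺_) (flip _≺?_) y x i ≡ F (flip _≺_) (flip _≺?_) y x j →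
                 F _≺_ _≺?_ x y i ≡ F _≺_ _≺?_ x y j
  F-opposite-≡ {i} {j} eq = trans (F-opposite i) (trans eq (sym (F-opposite j)))

module _ {n} (_≺_ : Rel (Fin (suc n)) 0ℓ) (_≺?_ : Decidable _≺_) (x y : Fin (suc n)) (j : ℕ) where
  open ≡-Reasoning

  F-≤-F-suc : (∀ {L} → WithGap _≺_ x y (suc j) L → SwappableDown _≺_ x L) →
              F _≺_ _≺?_ x y (suc j) ≤ F _≺_ _≺?_ x y (suc (suc j))
  F-≤-F-suc predecessor = F-≤ _≺_ _≺?_ x y φ φ-gap φ-injective
    where
    φ : ∀ {L} → WithGap _≺_ x y (suc j) L → Fin (suc n) → Fin (suc n)
    φ {L} p = move (L x) (L (proj₁ (predecessor p))) ∘ L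

    φ-gap : ∀ {L} (p : WithGap _≺_ x y (suc j) L) → WithGap _≺_ x y (suc (suc j)) (φ p)
    φ-gap {L} p@(le , gap) with predecessor p
    ... | u , u⋖x , u⊀x = moveDown-linearExtension _≺_ le u⋖x u⊀x , (begin
      toℕ (move (L x) (L u) (L y))                ≡⟨ move-above (L x) (L u) x<y (<-trans u<x x<y) ⟩
      toℕ (L y)                                   ≡⟨ gap ⟩
      toℕ (L x) + suc j                           ≡⟨ cong (_+ suc j) u⋖x ⟨
      suc (toℕ (L u)) + suc j                     ≡⟨ +-suc (toℕ (L u)) (suc j) ⟨
      toℕ (L u) + suc (suc j)                     ≡⟨ cong (λ t → toℕ t + suc (suc j)) (move-source (L x) (L u)) ⟨
      toℕ (move (L x) (L u) (L x)) + suc (suc j)  ∎)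
      where
      u<x : toℕ (L u) < toℕ (L x)
      u<x = subst (toℕ (L u) <_) u⋖x (n<1+n _)
      x<y : toℕ (L x) < toℕ (L y)
      x<y = subst (toℕ (L x) <_) (sym gap) (m<m+n _ z<s)

    φ-injective : ∀ {L M} (p : WithGap _≺_ x y (suc j) L) (q : WithGap _≺_ x y (suc j) M) →
                  φ p ≗ φ q → L ≗ M
    φ-injective {L} {M} p q eq = move∘-injective x-same u-same eq
      where
      u-same : L (proj₁ (predecessor p)) ≡ M (proj₁ (predecessor q))
      u-same = trans (sym (move-source (L x) _)) (trans (eq x) (move-source (M x) _))
      x-same : L x ≡ M x
      x-same = toℕ-injective (trans (sym (proj₁ (proj₂ (predecessor p))))
                 (trans (cong (suc ∘ toℕ) u-same) (proj₁ (proj₂ (predecessor q)))))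

  F-suc-≤-F : (∀ {L} → WithGap _≺_ x y (suc (suc j)) L → SwappableUp _≺_ x L) →
              F _≺_ _≺?_ x y (suc (suc j)) ≤ F _≺_ _≺?_ x y (suc j)
  F-suc-≤-F successor = F-≤ _≺_ _≺?_ x y ψ ψ-gap ψ-injective
    where
    ψ : ∀ {L} → WithGap _≺_ x y (suc (suc j)) L → Fin (suc n) → Fin (suc n)
    ψ {L} q = move (L x) (L (proj₁ (successor q))) ∘ L

    ψ-gap : ∀ {L} (q : WithGap _≺_ x y (suc (suc j)) L) → WithGap _≺_ x y (suc j) (ψ q)
    ψ-gap {L} q@(le , gap) with successor q
    ... | w , x⋖w , x⊀w = moveUp-linearExtension _≺_ le x⋖w x⊀w , (begin
      toℕ (move (L x) (L w) (L y))          ≡⟨ move-above (L x) (L w) (<-trans x<w w<y) w<y ⟩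
      toℕ (L y)                             ≡⟨ gap ⟩
      toℕ (L x) + suc (suc j)               ≡⟨ +-suc (toℕ (L x)) (suc j) ⟩
      suc (toℕ (L x)) + suc j               ≡⟨ cong (_+ suc j) x⋖w ⟩
      toℕ (L w) + suc j                     ≡⟨ cong (λ t → toℕ t + suc j) (move-source (L x) (L w)) ⟨
      toℕ (move (L x) (L w) (L x)) + suc j  ∎)
      where
      x<w : toℕ (L x) < toℕ (L w)
      x<w = subst (toℕ (L x) <_) x⋖w (n<1+n _)
      w<y : toℕ (L w) < toℕ (L y)
      w<y = subst₂ _<_ (trans (+-comm (toℕ (L x)) 1) x⋖w) (sym gap) (+-monoʳ-< (toℕ (L x)) (s<s z<s))

    ψ-injective : ∀ {L M} (p : WithGap _≺_ x y (suc (suc j)) L) (q : WithGap _≺_ x y (suc (suc j)) M) →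
                  ψ p ≗ ψ q → L ≗ M
    ψ-injective {L} {M} p q eq = move∘-injective x-same w-same eq
      where
      w-same : L (proj₁ (successor p)) ≡ M (proj₁ (successor q))
      w-same = trans (sym (move-source (L x) _)) (trans (eq x) (move-source (M x) _))
      x-same : L x ≡ M x
      x-same = toℕ-injective (suc-injective (trans (proj₁ (proj₂ (successor p)))
                 (trans (cong toℕ w-same) (sym (proj₁ (proj₂ (successor q)))))))

Flanked : ∀ {n} (_≺_ : Rel (Fin n) 0ℓ) (x y : Fin n) (k : ℕ) (z : Fin n) → Set
Flanked {n} _≺_ x y k z =
  (L : Fin n → Fin n) → IsLinearExtension _≺_ L → toℕ (L y) ≡ toℕ (L x) + k →
  Σ (Fin n) λ u → Σ (Fin n) λ v →
    Incomparable _≺_ u z × Incomparable _≺_ v z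
    × suc (toℕ (L u)) ≡ toℕ (L z) × suc (toℕ (L z)) ≡ toℕ (L v)

Flanked-flip : ∀ {n} (_≺_ : Rel (Fin n) 0ℓ) {x y k} → Flanked _≺_ x y k y → Flanked (flip _≺_) y x k y
Flanked-flip _≺_ flanked M le gap
  with flanked (opposite ∘ M) (opposite-linearExtension (flip _≺_) le) (opposite-gap _ gap)
... | u , v , (u⊀y , y⊀u) , (v⊀y , y⊀v) , u⋖y , y⋖v =
  v , u , (y⊀v , v⊀y) , (y⊀u , u⊀y) , opposite-adjacent y⋖v , opposite-adjacent u⋖y

module FlankedAtX {n} (_≺_ : Rel (Fin (suc n)) 0ℓ) (_≺?_ : Decidable _≺_) (≺-trans : Transitive _≺_)
                  (x y : Fin (suc n)) (j : ℕ) (flanked : Flanked _≺_ x y (suc (suc j)) x) where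

  k : ℕ
  k = suc (suc j)

  predecessor-incomparable : ∀ {L} → WithGap _≺_ x y k L →
                             ∀ {u} → suc (toℕ (L u)) ≡ toℕ (L x) → Incomparable _≺_ u x
  predecessor-incomparable {L} (le , gap) u⋖x with flanked L le gap
  ... | u′ , _ , u′∥x , _ , u′⋖x , _ =
    subst (λ a → Incomparable _≺_ a x) (position-injective _≺_ le (suc-injective (trans u′⋖x (sym u⋖x)))) u′∥x

  successor-incomparable : ∀ {L} → WithGap _≺_ x y k L →
                           ∀ {v} → suc (toℕ (L x)) ≡ toℕ (L v) → Incomparable _≺_ v x
  successor-incomparable {L} (le , gap) x⋖v with flanked L le gap
  ... | _ , v′ , _ , v′∥x , _ , x⋖v′ =
    subst (λ a → Incomparable _≺_ a x) (position-injective _≺_ le (trans (sym x⋖v′) x⋖v)) v′∥x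

  x-not-first : ∀ {L} → WithGap _≺_ x y k L → toℕ (L x) ≢ 0
  x-not-first {L} (le , gap) x≡0 with flanked L le gap
  ... | _ , _ , _ , _ , u⋖x , _ = 1+n≢0 (trans u⋖x x≡0)

  PredecessorBlocked : (Fin (suc n) → Fin (suc n)) → Set
  PredecessorBlocked L = toℕ (L x) ≡ 0 ⊎ ∃ λ u → suc (toℕ (L u)) ≡ toℕ (L x) × u ≺ x

  flanked⇒¬predecessorBlocked : ∀ {L} → WithGap _≺_ x y k L → ¬ PredecessorBlocked L
  flanked⇒¬predecessorBlocked g (inj₁ x≡0)             = x-not-first g x≡0
  flanked⇒¬predecessorBlocked g (inj₂ (u , u⋖x , u≺x)) = proj₁ (predecessor-incomparable g u⋖x) u≺x

  module ComparableSuccessor {L} (g : WithGap _≺_ x y (suc k) L)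
                             {w} (x⋖w : suc (toℕ (L x)) ≡ toℕ (L w)) (x≺w : x ≺ w) where
    open ≡-Reasoning
    private
      le : IsLinearExtension _≺_ L
      le = proj₁ g
      gap : toℕ (L y) ≡ toℕ (L x) + suc k
      gap = proj₂ g

    pos : Fin (suc n) → ℕ
    pos = toℕ ∘ L

    Between : Pred (Fin (suc n)) 0ℓ
    Between c = pos x < pos c × pos c < pos y

    x<y : pos x < pos y
    x<y = subst (pos x <_) (sym gap) (m<m+n _ z<s)

    w<c : ∀ {c} → w ≢ c → pos x < pos c → pos w < pos c
    w<c w≢c x<c = ≤∧≢⇒< (subst (_≤ pos _) x⋖w x<c) (w≢c ∘ position-injective _≺_ le)

    ¬movable-to-x : ∀ {c} → Between c → w ≢ c → ¬ IsLinearExtension _≺_ (move (L c) (L x) ∘ L)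
    ¬movable-to-x {c} (x<c , c<y) w≢c le′ = proj₂ (successor-incomparable (le′ , gap′) x⋖w′) x≺w
      where
      L′ : Fin (suc n) → Fin (suc n)
      L′ = move (L c) (L x) ∘ L
      x′ : toℕ (L′ x) ≡ suc (pos x)
      x′ = move-shiftUp (L c) (L x) ≤-refl x<c
      gap′ : toℕ (L′ y) ≡ toℕ (L′ x) + k
      gap′ = begin
        toℕ (L′ y)        ≡⟨ move-above (L c) (L x) c<y x<y ⟩
        pos y             ≡⟨ gap ⟩
        pos x + suc k     ≡⟨ +-suc (pos x) k ⟩
        suc (pos x) + k   ≡⟨ cong (_+ k) x′ ⟨
        toℕ (L′ x) + k    ∎
      x⋖w′ : suc (toℕ (L′ x)) ≡ toℕ (L′ w)
      x⋖w′ = begin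
        suc (toℕ (L′ x))  ≡⟨ cong suc x′ ⟩
        suc (suc (pos x)) ≡⟨ cong suc x⋖w ⟩
        suc (pos w)       ≡⟨ move-shiftUp (L c) (L x) (<⇒≤ (subst (pos x <_) x⋖w (n<1+n _))) (w<c w≢c x<c) ⟨
        toℕ (L′ w)        ∎

    after-x : ∀ {c} → Between c → x ≺ c
    after-x = descent⇒⊏ ≺-trans pos step
      where
      step : ∀ {c} → Between c → ∃ λ d → pos d < pos c × d ≺ c × (d ≡ x ⊎ Between d)
      step {c} c-between@(x<c , c<y) with w ≟ c
      ... | yes refl = x , x<c , x≺w , inj₁ refl
      ... | no w≢c with predecessor⊎movable _≺_ le _≺?_ c (L x) (<⇒≤ x<c)
      ...   | inj₁ (d , d≺c , x≤d) =
        d , ≺⇒position< _≺_ le d≺c , d≺c ,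
        Sum.map sym (λ x<d → x<d , <-trans (≺⇒position< _≺_ le d≺c) c<y) (position-≤⇒≡⊎< _≺_ le x≤d)
      ...   | inj₂ le′ = contradiction le′ (¬movable-to-x c-between w≢c)

    ¬movable-to-y : ∀ {c} → Between c → ¬ IsLinearExtension _≺_ (move (L c) (L y) ∘ L)
    ¬movable-to-y {c} (x<c , c<y) le′ = no-comparable-successor′ x-comparable-successor′
      where
      L′ : Fin (suc n) → Fin (suc n)
      L′ = move (L c) (L y) ∘ L
      x′ : toℕ (L′ x) ≡ pos x
      x′ = move-below (L c) (L y) x<c x<y
      gap′ : toℕ (L′ y) ≡ toℕ (L′ x) + k
      gap′ = suc-injective (begin
        suc (toℕ (L′ y))       ≡⟨ move-shiftDown (L c) (L y) c<y ≤-refl ⟩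
        pos y                  ≡⟨ gap ⟩
        pos x + suc k          ≡⟨ +-suc (pos x) k ⟩
        suc (pos x + k)        ≡⟨ cong (λ t → suc (t + k)) x′ ⟨
        suc (toℕ (L′ x) + k)   ∎)
      no-comparable-successor′ : ¬ ∃ λ v → suc (toℕ (L′ x)) ≡ toℕ (L′ v) × x ≺ v
      no-comparable-successor′ (v , x⋖v′ , x≺v) = proj₂ (successor-incomparable (le′ , gap′) x⋖v′) x≺v
      x-comparable-successor′ : ∃ λ v → suc (toℕ (L′ x)) ≡ toℕ (L′ v) × x ≺ v
      x-comparable-successor′ with w ≟ c
      ... | no w≢c = w , x⋖w′ , x≺w
        where
        w<c′ : pos w < pos c
        w<c′ = w<c w≢c x<c
        x⋖w′ : suc (toℕ (L′ x)) ≡ toℕ (L′ w)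
        x⋖w′ = trans (cong suc x′) (trans x⋖w (sym (move-below (L c) (L y) w<c′ (<-trans w<c′ c<y))))
      ... | yes refl = b , x⋖b′ , after-x (x<b , b<y)
        -- c = w has moved next to y, so x is now followed by the element b two places after it in L,
        -- which lies before y since k ≥ 2.
        where
        b+2<y : suc (suc (pos x)) < pos y
        b+2<y = subst₂ _<_ (+-comm (pos x) 2) (sym gap) (+-monoʳ-< (pos x) (s<s (s<s z<s)))
        b-exists : ∃ λ b → pos b ≡ suc (suc (pos x))
        b-exists = elementAt _≺_ le (<-trans b+2<y (toℕ<n (L y)))
        b : Fin (suc n)
        b = proj₁ b-exists
        b-pos : pos b ≡ suc (suc (pos x))
        b-pos = proj₂ b-exists
        x<b : pos x < pos b
        x<b = subst (pos x <_) (sym b-pos) (<-trans (n<1+n _) (n<1+n _))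
        b<y : pos b < pos y
        b<y = subst (_< pos y) (sym b-pos) b+2<y
        x⋖b′ : suc (toℕ (L′ x)) ≡ toℕ (L′ b)
        x⋖b′ = suc-injective (begin
          suc (suc (toℕ (L′ x)))   ≡⟨ cong (suc ∘ suc) x′ ⟩
          suc (suc (pos x))        ≡⟨ b-pos ⟨
          pos b                    ≡⟨ move-shiftDown (L w) (L y) (subst₂ _<_ x⋖w (sym b-pos) (n<1+n _)) (<⇒≤ b<y) ⟨
          suc (toℕ (L′ b))         ∎)

    before-y : ∀ {c} → Between c → c ≺ y
    before-y = descent⇒⊏ (Flip.transitive _≺_ ≺-trans) (λ c → suc n ∸ pos c) step
      where
      step : ∀ {c} → Between c → ∃ λ d → suc n ∸ pos d < suc n ∸ pos c × c ≺ d × (d ≡ y ⊎ Between d)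
      step {c} c-between@(x<c , c<y) with successor⊎movable _≺_ le _≺?_ c (L y) (<⇒≤ c<y)
      ... | inj₁ (d , c≺d , d≤y) =
        d , ∸-monoʳ-< (≺⇒position< _≺_ le c≺d) (<⇒≤ (toℕ<n (L d))) , c≺d ,
        Sum.map₂ (λ d<y → <-trans x<c (≺⇒position< _≺_ le c≺d) , d<y) (position-≤⇒≡⊎< _≺_ le d≤y)
      ... | inj₂ le′ = contradiction le′ (¬movable-to-y c-between)

  module BlockedPredecessor {L} (g : WithGap _≺_ x y (suc j) L) where
    open ≡-Reasoning
    private
      le : IsLinearExtension _≺_ L
      le = proj₁ g
      gap : toℕ (L y) ≡ toℕ (L x) + suc j
      gap = proj₂ g

    pos : Fin (suc n) → ℕ
    pos = toℕ ∘ L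

    x<y : pos x < pos y
    x<y = subst (pos x <_) (sym gap) (m<m+n _ z<s)

    ¬movable-to-y : PredecessorBlocked L → ∀ {c} → pos y < pos c →
                    ¬ IsLinearExtension _≺_ (move (L c) (L y) ∘ L)
    ¬movable-to-y blocked {c} y<c le′ = flanked⇒¬predecessorBlocked (le′ , gap′) (still-blocked blocked)
      where
      L′ : Fin (suc n) → Fin (suc n)
      L′ = move (L c) (L y) ∘ L
      unmoved : ∀ {a} → pos a ≤ pos x → toℕ (L′ a) ≡ pos a
      unmoved a≤x = move-below (L c) (L y) (≤-<-trans a≤x (<-trans x<y y<c)) (≤-<-trans a≤x x<y)
      gap′ : toℕ (L′ y) ≡ toℕ (L′ x) + k
      gap′ = begin
        toℕ (L′ y)             ≡⟨ move-shiftUp (L c) (L y) ≤-refl y<c ⟩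
        suc (pos y)            ≡⟨ cong suc gap ⟩
        suc (pos x + suc j)    ≡⟨ +-suc (pos x) (suc j) ⟨
        pos x + k              ≡⟨ cong (_+ k) (unmoved ≤-refl) ⟨
        toℕ (L′ x) + k         ∎
      still-blocked : PredecessorBlocked L → PredecessorBlocked L′
      still-blocked (inj₁ x≡0) = inj₁ (trans (unmoved ≤-refl) x≡0)
      still-blocked (inj₂ (u , u⋖x , u≺x)) =
        inj₂ (u , trans (cong suc (unmoved u≤x)) (trans u⋖x (sym (unmoved ≤-refl))) , u≺x)
        where
        u≤x : pos u ≤ pos x
        u≤x = <⇒≤ (subst (pos u <_) u⋖x (n<1+n _))

    after-y : PredecessorBlocked L → ∀ {c} → pos y < pos c → y ≺ c
    after-y blocked = descent⇒⊏ ≺-trans pos step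
      where
      step : ∀ {c} → pos y < pos c → ∃ λ d → pos d < pos c × d ≺ c × (d ≡ y ⊎ pos y < pos d)
      step {c} y<c with predecessor⊎movable _≺_ le _≺?_ c (L y) (<⇒≤ y<c)
      ... | inj₁ (d , d≺c , y≤d) = d , ≺⇒position< _≺_ le d≺c , d≺c , Sum.map₁ sym (position-≤⇒≡⊎< _≺_ le y≤d)
      ... | inj₂ le′ = contradiction le′ (¬movable-to-y blocked y<c)

    module _ {u} (u⋖x : suc (pos u) ≡ pos x) (u≺x : u ≺ x) where

      ¬movable-to-x : ∀ {c} → u ≢ c → pos c < pos x → ¬ IsLinearExtension _≺_ (move (L c) (L x) ∘ L)
      ¬movable-to-x {c} u≢c c<x le′ = flanked⇒¬predecessorBlocked (le′ , gap′) (inj₂ (u , u⋖x′ , u≺x))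
        where
        L′ : Fin (suc n) → Fin (suc n)
        L′ = move (L c) (L x) ∘ L
        c<u : pos c < pos u
        c<u = ≤∧≢⇒< (s≤s⁻¹ (subst (pos c <_) (sym u⋖x) c<x)) (u≢c ∘ position-injective _≺_ le ∘ sym)
        x′ : suc (toℕ (L′ x)) ≡ pos x
        x′ = move-shiftDown (L c) (L x) c<x ≤-refl
        gap′ : toℕ (L′ y) ≡ toℕ (L′ x) + k
        gap′ = begin
          toℕ (L′ y)                 ≡⟨ move-above (L c) (L x) (<-trans c<x x<y) x<y ⟩
          pos y                      ≡⟨ gap ⟩
          pos x + suc j              ≡⟨ cong (_+ suc j) x′ ⟨
          suc (toℕ (L′ x)) + suc j   ≡⟨ +-suc (toℕ (L′ x)) (suc j) ⟨
          toℕ (L′ x) + k             ∎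
        u⋖x′ : suc (toℕ (L′ u)) ≡ toℕ (L′ x)
        u⋖x′ = suc-injective (begin
          suc (suc (toℕ (L′ u)))     ≡⟨ cong suc (move-shiftDown (L c) (L x) c<u (<⇒≤ (subst (pos u <_) u⋖x (n<1+n _)))) ⟩
          suc (pos u)                ≡⟨ u⋖x ⟩
          pos x                      ≡⟨ x′ ⟨
          suc (toℕ (L′ x))           ∎)

    before-x : PredecessorBlocked L → ∀ {c} → pos c < pos x → c ≺ x
    before-x (inj₁ x≡0) c<x = contradiction (subst (_ <_) x≡0 c<x) λ ()
    before-x (inj₂ (u , u⋖x , u≺x)) = descent⇒⊏ (Flip.transitive _≺_ ≺-trans) (λ c → suc n ∸ pos c) step
      where
      step : ∀ {c} → pos c < pos x → ∃ λ d → suc n ∸ pos d < suc n ∸ pos c × c ≺ d × (d ≡ x ⊎ pos d < pos x)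
      step {c} c<x with u ≟ c
      ... | yes refl = x , ∸-monoʳ-< c<x (<⇒≤ (toℕ<n (L x))) , u≺x , inj₁ refl
      ... | no u≢c with successor⊎movable _≺_ le _≺?_ c (L x) (<⇒≤ c<x)
      ...   | inj₁ (d , c≺d , d≤x) =
        d , ∸-monoʳ-< (≺⇒position< _≺_ le c≺d) (<⇒≤ (toℕ<n (L d))) , c≺d , position-≤⇒≡⊎< _≺_ le d≤x
      ...   | inj₂ le′ = contradiction le′ (¬movable-to-x u⋖x u≺x u≢c c<x)

  module _ {L₀} (g₀ : WithGap _≺_ x y k L₀) where
    open ≤-Reasoning
    private
      le₀ : IsLinearExtension _≺_ L₀
      le₀ = proj₁ g₀
      gap₀ : toℕ (L₀ y) ≡ toℕ (L₀ x) + k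
      gap₀ = proj₂ g₀

    x⊀successor : ∀ {L} → WithGap _≺_ x y (suc k) L → ∀ {w} → suc (toℕ (L x)) ≡ toℕ (L w) → ¬ (x ≺ w)
    x⊀successor {L} g@(le , gap) {w} x⋖w x≺w = <-irrefl refl (begin-strict
      toℕ (L₀ y)              ≡⟨ gap₀ ⟩
      toℕ (L₀ x) + k          ≡⟨ +-comm (toℕ (L₀ x)) k ⟩
      k + toℕ (L₀ x)          <⟨ +-monoʳ-< k (n<1+n _) ⟩
      k + suc (toℕ (L₀ x))    ≤⟨ window⇒≤ _≺_ le le₀ bound x<y₀ between-in-L₀ ⟩
      toℕ (L₀ y)              ∎)
      where
      open ComparableSuccessor g x⋖w x≺w
      window-end : suc (pos x) + k ≡ pos y
      window-end = sym (trans gap (+-suc (pos x) k))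
      bound : suc (pos x) + k ≤ suc n
      bound = subst (_≤ suc n) (sym window-end) (<⇒≤ (toℕ<n (L y)))
      x<y₀ : toℕ (L₀ x) < toℕ (L₀ y)
      x<y₀ = subst (toℕ (L₀ x) <_) (sym gap₀) (m<m+n _ z<s)
      between-in-L₀ : ∀ c → suc (pos x) ≤ pos c → pos c < suc (pos x) + k →
                      suc (toℕ (L₀ x)) ≤ toℕ (L₀ c) × toℕ (L₀ c) < toℕ (L₀ y)
      between-in-L₀ c x<c c<end = ≺⇒position< _≺_ le₀ (after-x between) , ≺⇒position< _≺_ le₀ (before-y between)
        where
        between : Between c
        between = x<c , subst (pos c <_) window-end c<end

    ¬predecessorBlocked : ∀ {L} → WithGap _≺_ x y (suc j) L → ¬ PredecessorBlocked L
    ¬predecessorBlocked {L} g@(le , gap) blocked = <-irrefl refl (begin-strict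
      suc n                                     ≡⟨ m∸n+n≡m (toℕ<n (L y)) ⟨
      (suc n ∸ suc (pos y)) + suc (pos y)       <⟨ +-monoʳ-< (suc n ∸ suc (pos y)) (s<s y-in-L₀) ⟩
      (suc n ∸ suc (pos y)) + suc (toℕ (L₀ y))  ≤⟨ window⇒≤ _≺_ le le₀ (≤-reflexive (m+[n∸m]≡n (toℕ<n (L y))))
                                                     (toℕ<n (L₀ y)) above-y-in-L₀ ⟩
      suc n                                     ∎)
      where
      open BlockedPredecessor g
      above-y-in-L₀ : ∀ c → suc (pos y) ≤ pos c → pos c < suc (pos y) + (suc n ∸ suc (pos y)) →
                      suc (toℕ (L₀ y)) ≤ toℕ (L₀ c) × toℕ (L₀ c) < suc n
      above-y-in-L₀ c y<c _ = ≺⇒position< _≺_ le₀ (after-y blocked y<c) , toℕ<n (L₀ c)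
      x-in-L₀ : pos x ≤ toℕ (L₀ x)
      x-in-L₀ = subst (_≤ toℕ (L₀ x)) (+-identityʳ (pos x))
        (window⇒≤ _≺_ le le₀ (<⇒≤ (toℕ<n (L x))) z≤n (λ c _ c<x → z≤n , ≺⇒position< _≺_ le₀ (before-x blocked c<x)))
      y-in-L₀ : pos y < toℕ (L₀ y)
      y-in-L₀ = begin-strict
        pos y                 ≡⟨ gap ⟩
        pos x + suc j         ≤⟨ +-monoˡ-≤ (suc j) x-in-L₀ ⟩
        toℕ (L₀ x) + suc j    <⟨ +-monoʳ-< (toℕ (L₀ x)) (n<1+n _) ⟩
        toℕ (L₀ x) + k        ≡⟨ gap₀ ⟨
        toℕ (L₀ y)            ∎

    F-constant-near-k : F _≺_ _≺?_ x y k ≡ F _≺_ _≺?_ x y (suc k) × F _≺_ _≺?_ x y k ≡ F _≺_ _≺?_ x y (suc j)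
    F-constant-near-k =
      ≤-antisym (F-≤-F-suc _≺_ _≺?_ x y (suc j) swappableDown-k)
                (F-suc-≤-F _≺_ _≺?_ x y (suc j) swappableUp-k+1) ,
      ≤-antisym (F-suc-≤-F _≺_ _≺?_ x y j swappableUp-k) (F-≤-F-suc _≺_ _≺?_ x y j swappableDown-k-1)
      where
      swappableDown-k : ∀ {L} → WithGap _≺_ x y k L → SwappableDown _≺_ x L
      swappableDown-k {L} (le , gap) with flanked L le gap
      ... | u , _ , (u⊀x , _) , _ , u⋖x , _ = u , u⋖x , u⊀x

      swappableUp-k : ∀ {L} → WithGap _≺_ x y k L → SwappableUp _≺_ x L
      swappableUp-k {L} (le , gap) with flanked L le gap
      ... | _ , v , _ , (_ , x⊀v) , _ , x⋖v = v , x⋖v , x⊀v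

      swappableUp-k+1 : ∀ {L} → WithGap _≺_ x y (suc k) L → SwappableUp _≺_ x L
      swappableUp-k+1 {L} g@(le , gap) =
        Product.map₂ (λ x⋖w → x⋖w , x⊀successor g x⋖w) (element-after _≺_ le (<-trans x+1<y (toℕ<n (L y))))
        where
        x+1<y : suc (toℕ (L x)) < toℕ (L y)
        x+1<y = subst₂ _<_ (+-comm (toℕ (L x)) 1) (sym gap) (+-monoʳ-< (toℕ (L x)) (s<s z<s))

      swappableDown-k-1 : ∀ {L} → WithGap _≺_ x y (suc j) L → SwappableDown _≺_ x L
      swappableDown-k-1 {L} g@(le , _) =
        Product.map₂ (λ {u} u⋖x → u⋖x , λ u≺x → ¬predecessorBlocked g (inj₂ (u , u⋖x , u≺x)))
          (element-before _≺_ le (¬predecessorBlocked g ∘ inj₁))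

  F[k]≡F[k±1] : 0 < F _≺_ _≺?_ x y k →
                F _≺_ _≺?_ x y k ≡ F _≺_ _≺?_ x y (suc k) × F _≺_ _≺?_ x y k ≡ F _≺_ _≺?_ x y (suc j)
  F[k]≡F[k±1] F-positive =
    F-constant-near-k (proj₂ (nonempty-filter⇒∃ (withGap? _≺_ _≺?_ x y k) (allFuns (suc n) (suc n)) F-positive))

proposition8p8 : (n : ℕ) (_≺_ : Rel (Fin n) _) (_≺?_ : Decidable _≺_)
    → IsStrictPartialOrder _≡_ _≺_
    → (x y : Fin n) → ¬ (x ≡ y)
    → (k : ℕ) → 2 ≤ k → k + 2 ≤ n
    → 0 < F _≺_ _≺?_ x y k
    → (z : Fin n) → (z ≡ x ⊎ z ≡ y)
    → ((L : Fin n → Fin n) → IsLinearExtension _≺_ L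
        → toℕ (L y) ≡ toℕ (L x) + k
        → Σ (Fin n) λ u → Σ (Fin n) λ v →
            Incomparable _≺_ u z × Incomparable _≺_ v z
            × suc (toℕ (L u)) ≡ toℕ (L z) × suc (toℕ (L z)) ≡ toℕ (L v))
    → (F _≺_ _≺?_ x y k ≡ F _≺_ _≺?_ x y (suc k))
      × (F _≺_ _≺?_ x y k ≡ F _≺_ _≺?_ x y (k ∸ 1))
proposition8p8 (suc n) _≺_ _≺?_ spo x y _ (suc (suc j)) (s≤s (s≤s _)) _ F-positive z (inj₁ refl) flanked =
  FlankedAtX.F[k]≡F[k±1] _≺_ _≺?_ (IsStrictPartialOrder.trans spo) x y j flanked F-positive
proposition8p8 (suc n) _≺_ _≺?_ spo x y _ (suc (suc j)) (s≤s (s≤s _)) _ F-positive z (inj₂ refl) flanked =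
  Product.map (F-opposite-≡ _≺_ _≺?_ x y) (F-opposite-≡ _≺_ _≺?_ x y)
    (FlankedAtX.F[k]≡F[k±1] (flip _≺_) (flip _≺?_) (Flip.transitive _≺_ (IsStrictPartialOrder.trans spo)) y x j
      (Flanked-flip _≺_ flanked) (subst (0 <_) (F-opposite _≺_ _≺?_ x y _) F-positive))
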